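{- Let $m$ be a positive integer and let $F\subseteq\mathbb Z$ be a finite nonempty set whose elements are all congruent to one another modulo $m$ and are not divisible by $m$. Then $C=m\mathbb N\cup F$ arises as a minimal additive complement in $\mathbb Z$.
   Context: $\mathbb N=\{0,1,2,\dots\}$. For subsets $C,W$ of $\mathbb Z$, $C+W=\{c+w:c\in C,w\in W\}$. $C$ is a minimal additive complement (MAC) to $W$ if $C+W=\mathbb Z$ and no proper subset $C'\subsetneq C$ satisfies $C'+W=\mathbb Z$. $C$ arises as a MAC if there exists some $W\subseteq\mathbb Z$ to which $C$ is a MAC. -}

module Defs where

open import Level using (Level; _⊔_; suc)
open import Data.Integer using (ℤ; _+_)
open import Data.Product using (Σ; ∃; _×_)
open import Relation.Binary.PropositionalEquality using (_≡_)
open import Relation.Nullary using (¬_)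

Subsetℤ : Set₁
Subsetℤ = ℤ → Set

SumsetIsℤ : Subsetℤ → Subsetℤ → Set
SumsetIsℤ C W = ∀ (z : ℤ) → ∃ λ c → ∃ λ w → C c × W w × z ≡ c + w

_⊆ℤ_ : Subsetℤ → Subsetℤ → Set
C' ⊆ℤ C = ∀ x → C' x → C x

_⊊ℤ_ : Subsetℤ → Subsetℤ → Set
C' ⊊ℤ C = (C' ⊆ℤ C) × (∃ λ x → C x × ¬ C' x)

IsMAC : Subsetℤ → Subsetℤ → Set₁
IsMAC C W = SumsetIsℤ C W × (∀ (C' : Subsetℤ) → C' ⊊ℤ C → ¬ SumsetIsℤ C' W)

ArisesAsMAC : Subsetℤ → Set₁
ArisesAsMAC C = Σ Subsetℤ λ W → IsMAC C W

-- All elements of F lie in the class of a mod m; let M = max F and μ = min F. Take W to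
-- consist of 0, of every integer outside the classes of 0 and -a, and of those w ≡ -a
-- below -M (so that F + w < 0) that avoid the finitely many holes Z f - f' with f ≠ f',
-- where Z f = E (f - M - m) is a negative multiple of m and E > 2 (M - μ) keeps the Z f
-- apart. Then m n ≥ 0 is reached only as m n + 0, and Z f only as f + (Z f - f), so every
-- element of C is essential. For covering, the class of -a far down is hit by large
-- multiples of m, and a negative multiple z is M + (z - M) or μ + (z - μ) unless both are
-- holes, which by separation forces z = Z f.

module Submission where

open import Defs
open import Data.Nat using (ℕ; NonZero)
open import Data.Integer using (ℤ; +_; _-_; _*_)
open import Data.Integer.Divisibility using (_∣_)
open import Data.List using (List; _∷_)
open import Data.List.Membership.Propositional using (_∈_)
open import Data.Product using (∃)
open import Data.Sum using (_⊎_)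
open import Relation.Binary.PropositionalEquality using (_≡_)
open import Relation.Nullary using (¬_)

import Data.Nat as ℕ
import Data.Nat.Properties as ℕP
open import Data.Nat.Divisibility using (divides)
open import Data.Integer using (_+_; -_; _≤_; _<_; _≤?_; _≟_; ∣_∣; 0ℤ; 1ℤ; -1ℤ; _⊓_; nonNegative; -[1+_]; +≤+; -≤+; +<+; -<+)
open import Data.Integer.Properties
open import Data.Integer.Divisibility.Signed
  using (∣ᵤ⇒∣; ∣⇒∣ᵤ; ∣-refl; ∣m⇒∣m*n; ∣n⇒∣m*n; ∣m∣n⇒∣m-n; ∣m+n∣m⇒∣n)
  renaming (_∣_ to _∣ˢ_; _∣?_ to _∣ˢ?_)
open import Data.Integer.Tactic.RingSolver using (solve-∀)
open import Data.List.Extrema ≤-totalOrder using (max; min; argmax-sel; argmin-sel; v≤max⁺; xs≤max; min≤⊤; min≤xs)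
open import Data.List.Membership.Propositional using (find; lose)
open import Data.List.Relation.Unary.Any using (Any; here; there; any?)
import Data.List.Relation.Unary.All as All
open import Data.Product using (_,_; _×_)
open import Data.Sum using (inj₁; inj₂; [_,_]′)
open import Data.Empty using (⊥-elim)
open import Function using (id; _∘_)
open import Relation.Binary.PropositionalEquality using (refl; sym; trans; cong; cong₂; subst; _≢_; module ≡-Reasoning)
open import Relation.Nullary using (Dec; yes; no)
open import Relation.Nullary.Decidable using (map′; ¬?; _×-dec_)

Essential : Subsetℤ → Subsetℤ → ℤ → Set
Essential C W x = ∃ λ z → ∀ c w → C c → W w → z ≡ c + w → c ≡ x

sumset∧essential⇒IsMAC : {C W : Subsetℤ} →
  SumsetIsℤ C W → (∀ x → C x → Essential C W x) → IsMAC C W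
sumset∧essential⇒IsMAC {C} {W} C+W≡ℤ essential = C+W≡ℤ , minimal
  where
  minimal : ∀ C' → C' ⊊ℤ C → ¬ SumsetIsℤ C' W
  minimal C' (C'⊆C , x , Cx , x∉C') C'+W≡ℤ with essential x Cx
  ... | z , only-x with C'+W≡ℤ z
  ... | c , w , C'c , Ww , z≡c+w = x∉C' (subst C' (only-x c w (C'⊆C c C'c) Ww z≡c+w) C'c)

max-∈ : ∀ x xs → max x xs ∈ x ∷ xs
max-∈ x xs = [ here , there ]′ (argmax-sel id x xs)

min-∈ : ∀ x xs → min x xs ∈ x ∷ xs
min-∈ x xs = [ here , there ]′ (argmin-sel id x xs)

≤-max : ∀ {x xs y} → y ∈ x ∷ xs → y ≤ max x xs
≤-max {x} {xs} (here refl) = v≤max⁺ x xs (inj₁ ≤-refl)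
≤-max {x} {xs} (there y∈) = All.lookup (xs≤max x xs) y∈

min-≤ : ∀ {x xs y} → y ∈ x ∷ xs → min x xs ≤ y
min-≤ {x} {xs} (here refl) = min≤⊤ x xs
min-≤ {x} {xs} (there y∈) = All.lookup (min≤xs x xs) y∈

0≤i≤j⇒∣i∣≤∣j∣ : ∀ {i j} → 0ℤ ≤ i → i ≤ j → ∣ i ∣ ℕ.≤ ∣ j ∣
0≤i≤j⇒∣i∣≤∣j∣ (+≤+ _) (+≤+ i≤j) = i≤j

∣i-j∣≤∣u-l∣ : ∀ {l u i j} → l ≤ i → i ≤ u → l ≤ j → j ≤ u → ∣ i - j ∣ ℕ.≤ ∣ u - l ∣
∣i-j∣≤∣u-l∣ {l} {u} {i} {j} l≤i i≤u l≤j j≤u with ≤-total i j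
... | inj₁ i≤j = subst (ℕ._≤ ∣ u - l ∣) (∣i-j∣≡∣j-i∣ j i)
                   (0≤i≤j⇒∣i∣≤∣j∣ (i≤j⇒0≤j-i i≤j) (+-mono-≤ j≤u (neg-mono-≤ l≤i)))
... | inj₂ j≤i = 0≤i≤j⇒∣i∣≤∣j∣ (i≤j⇒0≤j-i j≤i) (+-mono-≤ i≤u (neg-mono-≤ l≤j))

i≤+∣i∣ : ∀ i → i ≤ + ∣ i ∣
i≤+∣i∣ (+ n) = ≤-refl
i≤+∣i∣ -[1+ n ] = -≤+

[1+n]*k≤n⇒k≡0 : ∀ n k → ℕ.suc n ℕ.* k ℕ.≤ n → k ≡ 0
[1+n]*k≤n⇒k≡0 n 0 _ = refl
[1+n]*k≤n⇒k≡0 n (ℕ.suc k) [1+n]*k≤n =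
  ⊥-elim (ℕP.n≮n n (ℕP.≤-trans (ℕP.m≤m*n (ℕ.suc n) (ℕ.suc k)) [1+n]*k≤n))

i-j≡k-l⇒k-i≡l-j : ∀ i j k l → i - j ≡ k - l → k - i ≡ l - j
i-j≡k-l⇒k-i≡l-j i j k l eq = begin
  k - i                          ≡⟨ regroup i j k l ⟩
  (l - j) + ((k - l) - (i - j))  ≡⟨ cong (λ t → (l - j) + ((k - l) - t)) eq ⟩
  (l - j) + ((k - l) - (k - l))  ≡⟨ cong (λ t → (l - j) + t) (+-inverseʳ (k - l)) ⟩
  (l - j) + 0ℤ                   ≡⟨ +-identityʳ (l - j) ⟩
  l - j                          ∎
  where
  open ≡-Reasoning
  regroup : ∀ i j k l → k - i ≡ (l - j) + ((k - l) - (i - j))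
  regroup = solve-∀

i-k≡j-k⇒i≡j : ∀ i j k → i - k ≡ j - k → i ≡ j
i-k≡j-k⇒i≡j i j k eq = sym (i-j≡0⇒i≡j j i (trans (i-j≡k-l⇒k-i≡l-j i k j k eq) (+-inverseʳ k)))

i≡j+[i-j] : ∀ i j → i ≡ j + (i - j)
i≡j+[i-j] = solve-∀

i≡j+k⇒i-j≡k : ∀ {i j k} → i ≡ j + k → i - j ≡ k
i≡j+k⇒i-j≡k {i} {j} {k} refl = [j+k]-j≡k j k
  where
  [j+k]-j≡k : ∀ j k → (j + k) - j ≡ k
  [j+k]-j≡k = solve-∀

nonNegative-multiple : ∀ m {z} → + m ∣ˢ z → 0ℤ ≤ z → ∃ λ n → z ≡ + m * + n
nonNegative-multiple m {z} m∣z 0≤z with ∣⇒∣ᵤ m∣z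
... | divides n ∣z∣≡n*m = n , (begin
  z               ≡⟨ sym (0≤i⇒+∣i∣≡i 0≤z) ⟩
  + ∣ z ∣         ≡⟨ cong +_ (trans ∣z∣≡n*m (ℕP.*-comm n m)) ⟩
  + (m ℕ.* n)     ≡⟨ pos-* m n ⟩
  + m * + n       ∎)
  where open ≡-Reasoning

below-by-multiple : ∀ m .{{_ : NonZero m}} z B → ∃ λ n → z - + m * + n < B
below-by-multiple m z B = n , (begin-strict
  z - + m * + n             ≡⟨ rearrange z B (+ m * + n) ⟩
  (z - B) - + m * + n + B   <⟨ +-monoˡ-< B m*n-dominates ⟩
  0ℤ + B                    ≡⟨ +-identityˡ B ⟩
  B                         ∎)
  where
  open ≤-Reasoning
  n : ℕ
  n = ℕ.suc ∣ z - B ∣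
  rearrange : ∀ z B c → z - c ≡ (z - B) - c + B
  rearrange = solve-∀
  z-B<m*n : z - B < + m * + n
  z-B<m*n = ≤-<-trans (i≤+∣i∣ (z - B))
    (<-≤-trans (+<+ (ℕP.n<1+n _)) (subst (+ n ≤_) (pos-* m n) (+≤+ (ℕP.m≤n*m n m))))
  m*n-dominates : (z - B) - + m * + n < 0ℤ
  m*n-dominates = subst ((z - B) - + m * + n <_) (+-inverseʳ (+ m * + n)) (+-monoˡ-< (- (+ m * + n)) z-B<m*n)

module MinimalComplement (m : ℕ) .{{_ : NonZero m}} (a : ℤ) (as : List ℤ)
  (congruent : ∀ {x y} → x ∈ a ∷ as → y ∈ a ∷ as → + m ∣ˢ (x - y))
  (nonzero-residue : ∀ {x} → x ∈ a ∷ as → ¬ (+ m ∣ˢ x)) where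

  F : List ℤ
  F = a ∷ as

  C : Subsetℤ
  C z = (∃ λ (n : ℕ) → z ≡ + m * + n) ⊎ z ∈ F

  a∈F : a ∈ F
  a∈F = here refl

  -- Opaque: unfolding max and min inside integer arithmetic makes type checking very slow.
  opaque
    M μ : ℤ
    M = max a as
    μ = min a as

    M∈F : M ∈ F
    M∈F = max-∈ a as

    μ∈F : μ ∈ F
    μ∈F = min-∈ a as

    ≤M : ∀ {x} → x ∈ F → x ≤ M
    ≤M = ≤-max

    μ≤ : ∀ {x} → x ∈ F → μ ≤ x
    μ≤ = min-≤

  D : ℕ
  D = ∣ M - μ ∣

  0≤M-μ : 0ℤ ≤ M - μ
  0≤M-μ = i≤j⇒0≤j-i (μ≤ M∈F)

  +D≡M-μ : + D ≡ M - μ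
  +D≡M-μ = 0≤i⇒+∣i∣≡i 0≤M-μ

  spread : ∀ {x y} → x ∈ F → y ∈ F → ∣ x - y ∣ ℕ.≤ D
  spread x∈ y∈ = ∣i-j∣≤∣u-l∣ (μ≤ x∈) (≤M x∈) (μ≤ y∈) (≤M y∈)

  E : ℤ
  E = + ℕ.suc (D ℕ.+ D)

  Z : ℤ → ℤ
  Z f = E * (f - M - + m)

  Z-multiple : ∀ {f} → f ∈ F → + m ∣ˢ Z f
  Z-multiple f∈ = ∣n⇒∣m*n E (∣m∣n⇒∣m-n (congruent f∈ M∈F) ∣-refl)

  Z-mono : ∀ {f g} → f ≤ g → Z f ≤ Z g
  Z-mono f≤g = *-monoˡ-≤-nonNeg E (+-monoˡ-≤ (- + m) (+-monoˡ-≤ (- M) f≤g))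

  Z≤-E : ∀ {f} → f ∈ F → Z f ≤ - E
  Z≤-E {f} f∈ = begin
    E * (f - M - + m)   ≤⟨ *-monoˡ-≤-nonNeg E f-M-m≤-1 ⟩
    E * -1ℤ             ≡⟨ trans (*-comm E -1ℤ) (-1*i≡-i E) ⟩
    - E                 ∎
    where
    open ≤-Reasoning
    f-M-m≤-1 : f - M - + m ≤ -1ℤ
    f-M-m≤-1 = begin
      f - M - + m    ≤⟨ +-monoˡ-≤ (- + m) (i≤j⇒i-j≤0 (≤M f∈)) ⟩
      0ℤ - + m       ≡⟨ +-identityˡ (- + m) ⟩
      - + m          ≤⟨ neg-mono-≤ (+≤+ (ℕ.>-nonZero⁻¹ m)) ⟩
      -1ℤ            ∎

  Z-separated : ∀ f g → ∣ Z g - Z f ∣ ℕ.≤ D ℕ.+ D → g ≡ f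
  Z-separated f g bound = i-j≡0⇒i≡j g f (∣i∣≡0⇒i≡0 (
    [1+n]*k≤n⇒k≡0 (D ℕ.+ D) ∣ g - f ∣ (subst (ℕ._≤ D ℕ.+ D) ∣Zg-Zf∣≡E∣g-f∣ bound)))
    where
    Zg-Zf≡E[g-f] : ∀ E g f M m → E * (g - M - m) - E * (f - M - m) ≡ E * (g - f)
    Zg-Zf≡E[g-f] = solve-∀
    ∣Zg-Zf∣≡E∣g-f∣ : ∣ Z g - Z f ∣ ≡ ℕ.suc (D ℕ.+ D) ℕ.* ∣ g - f ∣
    ∣Zg-Zf∣≡E∣g-f∣ = trans (cong ∣_∣ (Zg-Zf≡E[g-f] E g f M (+ m))) (abs-* E (g - f))

  Z-offset-bound : ∀ {f f'} → f ∈ F → f' ∈ F → (Z f - f') + (M - μ) < - M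
  Z-offset-bound {f} {f'} f∈ f'∈ = begin-strict
    (Z f - f') + (M - μ)
      ≤⟨ +-monoˡ-≤ (M - μ) (+-mono-≤ (Z≤-E f∈) (neg-mono-≤ (μ≤ f'∈))) ⟩
    (- E - μ) + (M - μ)                               ≡⟨ cong (λ d → (- (1ℤ + (d + d)) - μ) + (M - μ)) +D≡M-μ ⟩
    (- (1ℤ + ((M - μ) + (M - μ))) - μ) + (M - μ)      ≡⟨ simplify M μ ⟩
    -1ℤ + - M                                         <⟨ +-monoˡ-< (- M) -<+ ⟩
    0ℤ + - M                                          ≡⟨ +-identityˡ (- M) ⟩
    - M                                               ∎
    where
    open ≤-Reasoning
    simplify : ∀ M μ → (- (1ℤ + ((M - μ) + (M - μ))) - μ) + (M - μ) ≡ -1ℤ + - M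
    simplify = solve-∀

  Z-diagonal-bound : ∀ {f} → f ∈ F → Z f - f < - M
  Z-diagonal-bound f∈ = ≤-<-trans (i≤i+j _ (M - μ) {{nonNegative 0≤M-μ}}) (Z-offset-bound f∈ f∈)

  Hole : ℤ → Set
  Hole w = ∃ λ f → ∃ λ f' → f ∈ F × f' ∈ F × f' ≢ f × w ≡ Z f - f'

  hole? : ∀ w → Dec (Hole w)
  hole? w = map′ fromAny toAny (any? (λ f → any? (λ f' → ¬? (f' ≟ f) ×-dec (w ≟ Z f - f')) F) F)
    where
    Witnesses : Set
    Witnesses = Any (λ f → Any (λ f' → f' ≢ f × w ≡ Z f - f') F) F
    fromAny : Witnesses → Hole w
    fromAny ws with find ws
    ... | f , f∈ , ws' with find ws'
    ... | f' , f'∈ , f'≢f , w≡ = f , f' , f∈ , f'∈ , f'≢f , w≡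
    toAny : Hole w → Witnesses
    toAny (f , f' , f∈ , f'∈ , f'≢f , w≡) = lose f∈ (lose f'∈ (f'≢f , w≡))

  hole-lower-bound : ∀ {w} → Hole w → Z μ - M ≤ w
  hole-lower-bound (f , f' , f∈ , f'∈ , _ , refl) = +-mono-≤ (Z-mono (μ≤ f∈)) (neg-mono-≤ (≤M f'∈))

  hole-upper-bound : ∀ {w} → Hole w → w + (M - μ) < - M
  hole-upper-bound (f , f' , f∈ , f'∈ , _ , refl) = Z-offset-bound f∈ f'∈

  ¬Hole-Z-diagonal : ∀ {f} → f ∈ F → ¬ Hole (Z f - f)
  ¬Hole-Z-diagonal {f} f∈ (g , g' , g∈ , g'∈ , g'≢g , Zf-f≡Zg-g') = g'≢g (trans g'≡f (sym g≡f))
    where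
    Zg-Zf≡g'-f : Z g - Z f ≡ g' - f
    Zg-Zf≡g'-f = i-j≡k-l⇒k-i≡l-j (Z f) f (Z g) g' Zf-f≡Zg-g'
    g≡f : g ≡ f
    g≡f = Z-separated f g (subst (ℕ._≤ D ℕ.+ D) (cong ∣_∣ (sym Zg-Zf≡g'-f))
            (ℕP.≤-trans (spread g'∈ f∈) (ℕP.m≤m+n D D)))
    g'≡f : g' ≡ f
    g'≡f = i-j≡0⇒i≡j g' f (trans (sym Zg-Zf≡g'-f) (trans (cong (λ u → Z u - Z f) g≡f) (+-inverseʳ (Z f))))

  holes⇒Z : ∀ {z} → Hole (z - M) → Hole (z - μ) → ∃ λ f → f ∈ F × z ≡ Z f
  holes⇒Z {z} (f , f' , f∈ , f'∈ , _ , e₁) (g , g' , g∈ , g'∈ , _ , e₂) = f , f∈ , z≡Zf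
    where
    t : ℤ
    t = (M - f') + (g' - μ)
    Zg-Zf≡t : Z g - Z f ≡ t
    Zg-Zf≡t = begin
      Z g - Z f                          ≡⟨ regroup (Z g) (Z f) z ⟩
      (Z g - z) - (Z f - z)              ≡⟨ cong₂ _-_ (i-j≡k-l⇒k-i≡l-j z μ (Z g) g' e₂) (i-j≡k-l⇒k-i≡l-j z M (Z f) f' e₁) ⟩
      (g' - μ) - (f' - M)                ≡⟨ regroup' g' μ f' M ⟩
      t                                  ∎
      where
      open ≡-Reasoning
      regroup : ∀ A B z → A - B ≡ (A - z) - (B - z)
      regroup = solve-∀
      regroup' : ∀ g' μ f' M → (g' - μ) - (f' - M) ≡ (M - f') + (g' - μ)
      regroup' = solve-∀
    g≡f : g ≡ f
    g≡f = Z-separated f g (subst (ℕ._≤ D ℕ.+ D) (cong ∣_∣ (sym Zg-Zf≡t))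
            (ℕP.≤-trans (∣i+j∣≤∣i∣+∣j∣ (M - f') (g' - μ)) (ℕP.+-mono-≤ (spread M∈F f'∈) (spread g'∈ μ∈F))))
    t≡0 : t ≡ 0ℤ
    t≡0 = trans (sym Zg-Zf≡t) (trans (cong (λ u → Z u - Z f) g≡f) (+-inverseʳ (Z f)))
    M≤f' : M ≤ f'
    M≤f' = i-j≤0⇒i≤j (≤-trans (i≤i+j (M - f') (g' - μ) {{nonNegative (i≤j⇒0≤j-i (μ≤ g'∈))}}) (≤-reflexive t≡0))
    z≡Zf : z ≡ Z f
    z≡Zf = i-k≡j-k⇒i≡j z (Z f) M (trans e₁ (cong (λ u → Z f - u) (≤-antisym (≤M f'∈) M≤f')))

  data W (w : ℤ) : Set where
    origin  : w ≡ 0ℤ → W w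
    generic : ¬ (+ m ∣ˢ w) → ¬ (+ m ∣ˢ (w + a)) → W w
    deep    : + m ∣ˢ (w + a) → w < - M → ¬ Hole w → W w

  _∈C+W : ℤ → Set
  z ∈C+W = ∃ λ c → ∃ λ w → C c × W w × z ≡ c + w

  multiple : ∀ n → + m ∣ˢ (+ m * + n)
  multiple n = ∣m⇒∣m*n (+ n) ∣-refl

  multiple-shift : ∀ {c z} → c ∈ F → + m ∣ˢ z → + m ∣ˢ ((z - c) + a)
  multiple-shift {c} {z} c∈ m∣z = subst (+ m ∣ˢ_) (shift z c a) (∣m∣n⇒∣m-n m∣z (congruent c∈ a∈F))
    where
    shift : ∀ z c a → z - (c - a) ≡ (z - c) + a
    shift = solve-∀

  via-F : ∀ {c z} → c ∈ F → + m ∣ˢ z → z - c < - M → ¬ Hole (z - c) → z ∈C+W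
  via-F {c} {z} c∈ m∣z bound ¬hole =
    c , z - c , inj₂ c∈ , deep (multiple-shift c∈ m∣z) bound ¬hole , i≡j+[i-j] z c

  Z-covered : ∀ {f} → f ∈ F → Z f ∈C+W
  Z-covered f∈ = via-F f∈ (Z-multiple f∈) (Z-diagonal-bound f∈) (¬Hole-Z-diagonal f∈)

  cover-negative-multiple : ∀ {z} → + m ∣ˢ z → z < 0ℤ → z ∈C+W
  cover-negative-multiple {z} m∣z z<0 with hole? (z - M) | hole? (z - μ)
  ... | no ¬hole | _ = via-F M∈F m∣z (subst (z - M <_) (+-identityˡ (- M)) (+-monoˡ-< (- M) z<0)) ¬hole
  ... | yes hole | no ¬hole = via-F μ∈F m∣z (subst (_< - M) (telescope z M μ) (hole-upper-bound hole)) ¬hole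
    where
    telescope : ∀ z M μ → (z - M) + (M - μ) ≡ z - μ
    telescope = solve-∀
  ... | yes hole | yes hole' = covered (holes⇒Z hole hole')
    where
    covered : (∃ λ f → f ∈ F × z ≡ Z f) → z ∈C+W
    covered (f , f∈ , z≡Zf) = subst _∈C+W (sym z≡Zf) (Z-covered f∈)

  cover-far : ∀ {z} → + m ∣ˢ (z + a) → z ∈C+W
  cover-far {z} m∣z+a = covered (below-by-multiple m z ((Z μ - M) ⊓ (- M)))
    where
    covered : (∃ λ n → z - + m * + n < (Z μ - M) ⊓ (- M)) → z ∈C+W
    covered (n , w<bound) =
      + m * + n , w , inj₁ (n , refl) , deep m∣w+a w<-M ¬hole , i≡j+[i-j] z (+ m * + n)
      where
      w : ℤ
      w = z - + m * + n
      m∣w+a : + m ∣ˢ (w + a)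
      m∣w+a = subst (+ m ∣ˢ_) (swap z a (+ m * + n)) (∣m∣n⇒∣m-n m∣z+a (multiple n))
        where
        swap : ∀ z a c → (z + a) - c ≡ (z - c) + a
        swap = solve-∀
      w<-M : w < - M
      w<-M = <-≤-trans w<bound (i⊓j≤j (Z μ - M) (- M))
      ¬hole : ¬ Hole w
      ¬hole hole = <⇒≱ (<-≤-trans w<bound (i⊓j≤i (Z μ - M) (- M))) (hole-lower-bound hole)

  cover : SumsetIsℤ C W
  cover z with + m ∣ˢ? z | + m ∣ˢ? (z + a)
  ... | yes m∣z | _ with 0ℤ ≤? z
  ...   | yes 0≤z = z , 0ℤ , inj₁ (nonNegative-multiple m m∣z 0≤z) , origin refl , sym (+-identityʳ z)
  ...   | no  0≰z = cover-negative-multiple m∣z (≰⇒> 0≰z)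
  cover z | no m∤z | no m∤z+a = + m * + 0 , z , inj₁ (0 , refl) , generic m∤z m∤z+a , sym m*0+z≡z
    where
    m*0+z≡z : + m * + 0 + z ≡ z
    m*0+z≡z = trans (cong (_+ z) (*-zeroʳ (+ m))) (+-identityˡ z)
  cover z | no _ | yes m∣z+a = cover-far m∣z+a

  F+deep<0 : ∀ {c w} → c ∈ F → w < - M → c + w < 0ℤ
  F+deep<0 {c} {w} c∈ w<-M = subst (c + w <_) (+-inverseʳ M) (+-mono-≤-< (≤M c∈) w<-M)

  0≤multiple : ∀ n → 0ℤ ≤ + m * + n
  0≤multiple n = subst (0ℤ ≤_) (pos-* m n) (+≤+ ℕ.z≤n)

  multiple-decomposition : ∀ {z c w} → + m ∣ˢ z → C c → W w → z ≡ c + w →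
    w ≡ 0ℤ ⊎ (c ∈ F × w < - M × ¬ Hole w)
  multiple-decomposition _ _ (origin w≡0) _ = inj₁ w≡0
  multiple-decomposition m∣z (inj₁ (n , refl)) (generic m∤w _) refl =
    ⊥-elim (m∤w (∣m+n∣m⇒∣n m∣z (multiple n)))
  multiple-decomposition {c = c} {w} m∣z (inj₂ c∈) (generic _ m∤w+a) refl =
    ⊥-elim (m∤w+a (subst (+ m ∣ˢ_) (cancel c w a) (∣m∣n⇒∣m-n m∣z (congruent c∈ a∈F))))
    where
    cancel : ∀ c w a → (c + w) - (c - a) ≡ w + a
    cancel = solve-∀
  multiple-decomposition m∣z (inj₁ (n , refl)) (deep m∣w+a _ _) refl =
    ⊥-elim (nonzero-residue a∈F (∣m+n∣m⇒∣n m∣w+a (∣m+n∣m⇒∣n m∣z (multiple n))))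
  multiple-decomposition _ (inj₂ c∈) (deep _ w<-M ¬hole) _ = inj₂ (c∈ , w<-M , ¬hole)

  Z∉C : ∀ {f} → f ∈ F → ¬ C (Z f)
  Z∉C f∈ (inj₁ (n , Zf≡m*n)) = <⇒≱ (≤-<-trans (Z≤-E f∈) -<+) (subst (0ℤ ≤_) (sym Zf≡m*n) (0≤multiple n))
  Z∉C f∈ (inj₂ Zf∈) = nonzero-residue Zf∈ (Z-multiple f∈)

  ¬Hole⇒diagonal : ∀ {f c} → f ∈ F → c ∈ F → ¬ Hole (Z f - c) → c ≡ f
  ¬Hole⇒diagonal {f} {c} f∈ c∈ ¬hole with c ≟ f
  ... | yes c≡f = c≡f
  ... | no  c≢f = ⊥-elim (¬hole (f , c , f∈ , c∈ , c≢f , refl))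

  essential : ∀ x → C x → Essential C W x
  essential x (inj₁ (n , x≡m*n)) = x , only-x
    where
    only-x : ∀ c w → C c → W w → x ≡ c + w → c ≡ x
    only-x c w Cc Ww x≡c+w with multiple-decomposition (subst (+ m ∣ˢ_) (sym x≡m*n) (multiple n)) Cc Ww x≡c+w
    ... | inj₁ w≡0 = sym (i-j≡0⇒i≡j x c (trans (i≡j+k⇒i-j≡k x≡c+w) w≡0))
    ... | inj₂ (c∈ , w<-M , _) =
      ⊥-elim (<⇒≱ (subst (_< 0ℤ) (sym x≡c+w) (F+deep<0 c∈ w<-M)) (subst (0ℤ ≤_) (sym x≡m*n) (0≤multiple n)))
  essential f (inj₂ f∈) = Z f , only-f
    where
    only-f : ∀ c w → C c → W w → Z f ≡ c + w → c ≡ f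
    only-f c w Cc Ww Zf≡c+w with multiple-decomposition (Z-multiple f∈) Cc Ww Zf≡c+w
    ... | inj₁ w≡0 = ⊥-elim (Z∉C f∈ (subst C (sym (i-j≡0⇒i≡j (Z f) c (trans (i≡j+k⇒i-j≡k Zf≡c+w) w≡0))) Cc))
    ... | inj₂ (c∈ , _ , ¬hole) = ¬Hole⇒diagonal f∈ c∈ (subst (¬_ ∘ Hole) (sym (i≡j+k⇒i-j≡k Zf≡c+w)) ¬hole)

  arisesAsMAC : ArisesAsMAC C
  arisesAsMAC = W , sumset∧essential⇒IsMAC cover essential

proposition2 : (m : ℕ) → .{{_ : NonZero m}} → (a : ℤ) → (as : List ℤ)
    → (∀ x y → x ∈ a ∷ as → y ∈ a ∷ as → (+ m) ∣ (x - y))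
    → (∀ x → x ∈ a ∷ as → ¬ ((+ m) ∣ x))
    → ArisesAsMAC (λ z → (∃ λ (n : ℕ) → z ≡ (+ m) * (+ n)) ⊎ (z ∈ a ∷ as))
proposition2 m a as congruent nonzero-residue =
  MinimalComplement.arisesAsMAC m a as
    (λ x∈ y∈ → ∣ᵤ⇒∣ (congruent _ _ x∈ y∈))
    (λ x∈ m∣x → nonzero-residue _ x∈ (∣⇒∣ᵤ m∣x))
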